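{- In the weighted query-commit model, the optimal expected utility $\mathrm{OPT}$ over all query-commit algorithms is at most the optimal value of the linear program $\mathrm{LP}_{QC}$.
   Context: Weighted query-commit model: $G=(A,B,E)$ bipartite; each edge $e$ has weight $w(e)\ge0$ and exists independently with probability $p_e$. An algorithm adaptively queries edges; a query reveals whether the edge exists, and if it does the algorithm must add it to its output; the output must be a matching (so only edges disjoint from the current output may be queried). The utility is $\mathbb{E}[\sum_{e\in M}w(e)]$ for output $M$; $\mathrm{OPT}$ is the maximum over all such algorithms. For a vertex $u$, $\delta(u)$ is the set of incident edges, and for $F\subseteq E$, $f(F)=1-\prod_{e\in F}(1-p_e)$. $\mathrm{LP}_{QC}$: maximize $\sum_{e\in E}x_e w(e)$ subject to $\sum_{e\in F}x_e\le f(F)$ for all $u\in A\cup B$ and all $F\subseteq\delta(u)$, and $x_e\ge0$ for all $e\in E$. -}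

module Defs where

open import Level using (Level; _⊔_; suc)
open import Algebra.Bundles using (CommutativeRing)
open import Relation.Binary.Structures using (IsTotalOrder)
open import Relation.Nullary using (¬_)
open import Data.Product using (∃; _×_; _,_)
open import Data.Sum using (_⊎_; inj₁; inj₂)
open import Data.Nat using (ℕ) renaming (zero to zeroℕ; suc to sucℕ)
open import Data.Fin using (Fin) renaming (zero to fzero; suc to fsuc)
open import Data.Bool using (Bool; true; false; if_then_else_)
open import Data.List using (List; []; _∷_)
open import Data.List.Membership.Propositional using (_∈_; _∉_)
open import Data.List.Relation.Unary.All using (All)
open import Relation.Binary.PropositionalEquality using (_≡_)

-- Ordered fields (the scalar domain; ℝ is an instance).

record OrderedField (c ℓ₁ ℓ₂ : Level) : Set (suc (c ⊔ ℓ₁ ⊔ ℓ₂)) where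
  field
    commutativeRing : CommutativeRing c ℓ₁
  open CommutativeRing commutativeRing public
  infix 4 _≤_
  field
    _≤_          : Carrier → Carrier → Set ℓ₂
    isTotalOrder : IsTotalOrder _≈_ _≤_
    +-mono-≤ˡ    : ∀ {x y} z → x ≤ y → (z + x) ≤ (z + y)
    *-nonneg     : ∀ {x y} → 0# ≤ x → 0# ≤ y → 0# ≤ (x * y)
    0≉1          : ¬ (0# ≈ 1#)
    inverse      : ∀ x → ¬ (x ≈ 0#) → ∃ λ y → (x * y) ≈ 1#

-- Finite bipartite (multi)graphs: A = Fin a, B = Fin b, E = Fin m,
-- edge e joins left e ∈ A and right e ∈ B.

record BipGraph : Set where
  field
    a b m : ℕ
    left  : Fin m → Fin a
    right : Fin m → Fin b

module QueryCommit {c ℓ₁ ℓ₂} (K : OrderedField c ℓ₁ ℓ₂) (G : BipGraph) where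
  open OrderedField K
  open BipGraph G

  Edge : Set
  Edge = Fin m

  Vertex : Set
  Vertex = Fin a ⊎ Fin b

  Incident : Vertex → Edge → Set
  Incident (inj₁ x) e = left e ≡ x
  Incident (inj₂ y) e = right e ≡ y

  Disjoint : Edge → Edge → Set
  Disjoint e e' = ¬ (left e ≡ left e') × ¬ (right e ≡ right e')

  sumFin : ∀ {n} → (Fin n → Carrier) → Carrier
  sumFin {zeroℕ}  g = 0#
  sumFin {sucℕ n} g = g fzero + sumFin (λ i → g (fsuc i))

  prodFin : ∀ {n} → (Fin n → Carrier) → Carrier
  prodFin {zeroℕ}  g = 1#
  prodFin {sucℕ n} g = g fzero * prodFin (λ i → g (fsuc i))

  EdgeSet : Set
  EdgeSet = Edge → Bool

  sumOver : EdgeSet → (Edge → Carrier) → Carrier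
  sumOver F x = sumFin (λ e → if F e then x e else 0#)

  f : (Edge → Carrier) → EdgeSet → Carrier
  f p F = 1# - prodFin (λ e → if F e then (1# - p e) else 1#)

  _⊆δ_ : EdgeSet → Vertex → Set
  F ⊆δ u = ∀ e → F e ≡ true → Incident u e

  LPFeasible : (Edge → Carrier) → (Edge → Carrier) → Set (ℓ₂)
  LPFeasible p x =
    (∀ e → 0# ≤ x e) ×
    (∀ (u : Vertex) (F : EdgeSet) → F ⊆δ u → sumOver F x ≤ f p F)

  LPValue : (Edge → Carrier) → (Edge → Carrier) → Carrier
  LPValue w x = sumFin (λ e → x e * w e)

  -- Query-commit algorithms as (deterministic, adaptive) decision trees.
  -- query e yes no : query edge e; continue with `yes` if e exists
  -- (e is then committed to the output), with `no` otherwise.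

  data Alg : Set where
    stop  : Alg
    query : Edge → Alg → Alg → Alg

  -- Valid M Q T : T is a legal algorithm when the current output
  -- matching is M and the set of already-queried edges is Q.
  -- Only edges disjoint from the current output may be queried;
  -- an edge is never queried twice (re-querying an edge already found
  -- absent reveals nothing and cannot change the output).
  data Valid : List Edge → List Edge → Alg → Set where
    stop  : ∀ {M Q} → Valid M Q stop
    query : ∀ {M Q e yes no} →
            All (Disjoint e) M → e ∉ Q →
            Valid (e ∷ M) (e ∷ Q) yes →
            Valid M (e ∷ Q) no →
            Valid M Q (query e yes no)

  -- Expected utility E[Σ_{e∈M} w(e)] when each edge e exists
  -- independently with probability p e.
  utility : (Edge → Carrier) → (Edge → Carrier) → Alg → Carrier
  utility p w stop = 0#
  utility p w (query e yes no) =
    (p e * (w e + utility p w yes)) + ((1# - p e) * utility p w no)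

-- Let x_e be the probability that the algorithm T commits to e.  By
-- linearity of expectation the utility of T is Σ_e x_e w(e), so it suffices
-- that x is LP-feasible.  For a vertex u and a set F ⊆ δ(u) of edges not yet
-- queried, Σ_{e∈F} x_e ≤ f(F) follows by induction on T.  If the first query
-- e lies outside F, both subtrees satisfy the bound and the left side is
-- their convex combination.  If e ∈ F, the yes-branch has committed to e and
-- so never commits to another edge at u, the no-branch satisfies the bound
-- for F ∖ e, and f(F) = p_e + (1 − p_e) f(F ∖ e).

module Submission where

open import Defs
open import Level using (Level)
open import Algebra.Bundles using (CommutativeMonoid; Semiring)
open import Data.Bool using (Bool; true; false; if_then_else_)
open import Data.Fin using (Fin; _≟_) renaming (zero to fzero; suc to fsuc)
open import Data.Fin.Properties using (punchInᵢ≢i)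
open import Data.List using (List; []; _∷_)
open import Data.List.Membership.Propositional using (_∈_; _∉_)
open import Data.List.Relation.Unary.All as All using (All)
open import Data.List.Relation.Unary.Any using (here; there)
open import Data.Nat using (ℕ)
open import Data.Product using (∃; _×_; _,_; proj₁; proj₂)
open import Data.Sum as Sum using (_⊎_; inj₁; inj₂)
open import Data.Vec.Functional using (Vector; removeAt)
open import Function using (_∘_)
open import Relation.Binary.Bundles using (Poset)
open import Relation.Binary.PropositionalEquality as ≡ using (_≡_; _≢_)
open import Relation.Binary.Structures using (IsTotalOrder)
open import Relation.Nullary using (¬_; does; yes; no)
open import Relation.Nullary.Decidable using (dec-true; dec-false)
import Algebra.Properties.CommutativeMonoid.Sum as CommutativeMonoidSum
import Algebra.Properties.Ring as RingProperties
import Algebra.Properties.Semiring.Sum as SemiringSum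
import Algebra.Solver.Ring.NaturalCoefficients.Default as NaturalCoefficients
import Relation.Binary.Reasoning.PartialOrder as PosetReasoning
import Relation.Binary.Reasoning.Setoid as SetoidReasoning

module _ {a ℓ} (M : CommutativeMonoid a ℓ) where
  open CommutativeMonoid M
  open CommutativeMonoidSum M

  sum-split-at : ∀ {n} {g h : Vector Carrier n} (e : Fin n) →
                 (∀ i → i ≢ e → g i ≈ h i) → h e ≈ ε → sum g ≈ g e ∙ sum h
  sum-split-at {ℕ.suc n} {g} {h} e g≈h h[e]≈ε = begin
    sum g                        ≈⟨ sum-remove g ⟩
    g e ∙ sum (removeAt g e)     ≈⟨ ∙-congˡ (sum-cong-≋ λ j → g≈h _ (punchInᵢ≢i e j)) ⟩
    g e ∙ sum (removeAt h e)     ≈⟨ ∙-congˡ sum-h ⟨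
    g e ∙ sum h                  ∎
    where
    open SetoidReasoning setoid
    sum-h : sum h ≈ sum (removeAt h e)
    sum-h = trans (sum-remove {i = e} h) (trans (∙-congʳ h[e]≈ε) (identityˡ _))

module _ {a ℓ} (R : Semiring a ℓ) where
  open Semiring R
  open SemiringSum R

  sum-linear : ∀ {n} (x y : Carrier) (f g h : Vector Carrier n) →
               sum (λ i → x * (f i + g i) + y * h i) ≈ x * (sum f + sum g) + y * sum h
  sum-linear x y f g h = begin
    sum (λ i → x * (f i + g i) + y * h i)
      ≈⟨ ∑-distrib-+ (λ i → x * (f i + g i)) (λ i → y * h i) ⟩
    sum (λ i → x * (f i + g i)) + sum (λ i → y * h i)
      ≈⟨ +-cong (sym (*-distribˡ-sum x (λ i → f i + g i))) (sym (*-distribˡ-sum y h)) ⟩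
    x * sum (λ i → f i + g i) + y * sum h
      ≈⟨ +-congʳ (*-congˡ (∑-distrib-+ f g)) ⟩
    x * (sum f + sum g) + y * sum h ∎
    where open SetoidReasoning setoid

module OrderedFieldProperties {c ℓ₁ ℓ₂} (K : OrderedField c ℓ₁ ℓ₂) where
  open OrderedField K
  open IsTotalOrder isTotalOrder using (isPartialOrder; total)
  open IsTotalOrder isTotalOrder public using () renaming (refl to ≤-refl; reflexive to ≤-reflexive)
  open CommutativeMonoidSum *-commutativeMonoid using () renaming (sum to product)
  open RingProperties ring using (-1*x≈-x; -‿involutive; xyx⁻¹≈y)
  open NaturalCoefficients commutativeSemiring using (solve; _:=_; _:+_; _:*_; con)

  poset : Poset c ℓ₁ ℓ₂
  poset = record { isPartialOrder = isPartialOrder }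

  open PosetReasoning poset

  x+[y-x]≈y : ∀ x y → x + (y - x) ≈ y
  x+[y-x]≈y x y = trans (sym (+-assoc x y (- x))) (xyx⁻¹≈y x y)

  +-mono-≤ʳ : ∀ {x y} z → x ≤ y → x + z ≤ y + z
  +-mono-≤ʳ {x} {y} z x≤y = begin
    x + z ≈⟨ +-comm x z ⟩
    z + x ≤⟨ +-mono-≤ˡ z x≤y ⟩
    z + y ≈⟨ +-comm z y ⟩
    y + z ∎

  +-mono-≤ : ∀ {x y u v} → x ≤ y → u ≤ v → x + u ≤ y + v
  +-mono-≤ {x} {y} {u} {v} x≤y u≤v = begin
    x + u ≤⟨ +-mono-≤ˡ x u≤v ⟩
    x + v ≤⟨ +-mono-≤ʳ v x≤y ⟩
    y + v ∎

  +-nonneg : ∀ {x y} → 0# ≤ x → 0# ≤ y → 0# ≤ x + y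
  +-nonneg {x} {y} 0≤x 0≤y = begin
    0#      ≈⟨ +-identityʳ 0# ⟨
    0# + 0# ≤⟨ +-mono-≤ 0≤x 0≤y ⟩
    x + y   ∎

  x≤y⇒0≤y-x : ∀ {x y} → x ≤ y → 0# ≤ y - x
  x≤y⇒0≤y-x {x} {y} x≤y = begin
    0#     ≈⟨ -‿inverseʳ x ⟨
    x - x  ≤⟨ +-mono-≤ʳ (- x) x≤y ⟩
    y - x  ∎

  0≤x⇒-x≤0 : ∀ {x} → 0# ≤ x → - x ≤ 0#
  0≤x⇒-x≤0 {x} 0≤x = begin
    - x      ≈⟨ +-identityʳ (- x) ⟨
    - x + 0# ≤⟨ +-mono-≤ˡ (- x) 0≤x ⟩
    - x + x  ≈⟨ -‿inverseˡ x ⟩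
    0#       ∎

  *-mono-≤ˡ : ∀ {x y z} → 0# ≤ z → x ≤ y → z * x ≤ z * y
  *-mono-≤ˡ {x} {y} {z} 0≤z x≤y = begin
    z * x                ≈⟨ +-identityʳ (z * x) ⟨
    z * x + 0#           ≤⟨ +-mono-≤ˡ (z * x) (*-nonneg 0≤z (x≤y⇒0≤y-x x≤y)) ⟩
    z * x + z * (y - x)  ≈⟨ distribˡ z x (y - x) ⟨
    z * (x + (y - x))    ≈⟨ *-congˡ (x+[y-x]≈y x y) ⟩
    z * y                ∎

  0≤1 : 0# ≤ 1#
  0≤1 with total 0# 1#
  ... | inj₁ 0≤1 = 0≤1
  ... | inj₂ 1≤0 = begin
    0#              ≤⟨ *-nonneg 0≤-1 0≤-1 ⟩
    - 1# * - 1#     ≈⟨ -1*x≈-x (- 1#) ⟩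
    - (- 1#)        ≈⟨ -‿involutive 1# ⟩
    1#              ∎
    where
    0≤-1 : 0# ≤ - 1#
    0≤-1 = begin
      0#       ≈⟨ -‿inverseʳ 1# ⟨
      1# - 1#  ≤⟨ +-mono-≤ʳ (- 1#) 1≤0 ⟩
      0# - 1#  ≈⟨ +-identityˡ (- 1#) ⟩
      - 1#     ∎

  0≤x⇒1-x≤1 : ∀ {x} → 0# ≤ x → 1# - x ≤ 1#
  0≤x⇒1-x≤1 {x} 0≤x = begin
    1# - x   ≤⟨ +-mono-≤ˡ 1# (0≤x⇒-x≤0 0≤x) ⟩
    1# + 0#  ≈⟨ +-identityʳ 1# ⟩
    1#       ∎

  convex-combination-self : ∀ a x → a * (0# + x) + (1# - a) * x ≈ x
  convex-combination-self a x = begin-equality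
    a * (0# + x) + (1# - a) * x  ≈⟨ solve 3 (λ a b x → a :* (con 0 :+ x) :+ b :* x := (a :+ b) :* x) refl a (1# - a) x ⟩
    (a + (1# - a)) * x           ≈⟨ *-congʳ (x+[y-x]≈y a 1#) ⟩
    1# * x                       ≈⟨ *-identityˡ x ⟩
    x                            ∎

  product≤1 : ∀ {n} (g : Vector Carrier n) →
              (∀ i → 0# ≤ g i) → (∀ i → g i ≤ 1#) → product g ≤ 1#
  product≤1 {ℕ.zero}  g 0≤g g≤1 = ≤-refl
  product≤1 {ℕ.suc n} g 0≤g g≤1 = begin
    g fzero * product (g ∘ fsuc)
      ≤⟨ *-mono-≤ˡ (0≤g fzero) (product≤1 (g ∘ fsuc) (0≤g ∘ fsuc) (g≤1 ∘ fsuc)) ⟩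
    g fzero * 1#
      ≈⟨ *-identityʳ (g fzero) ⟩
    g fzero
      ≤⟨ g≤1 fzero ⟩
    1# ∎

module QueryCommitProperties {c ℓ₁ ℓ₂} (K : OrderedField c ℓ₁ ℓ₂) (G : BipGraph) where
  open OrderedField K
  open QueryCommit K G

  open BipGraph G using (m)
  open RingProperties ring using (x[y-z]≈xy-xz)
  open OrderedFieldProperties K
  open PosetReasoning poset hiding (stop)
  open SemiringSum semiring using (sum; sum-cong-≋; sum-replicate-zero)
  open CommutativeMonoidSum *-commutativeMonoid using () renaming (sum to product)
  open NaturalCoefficients commutativeSemiring using (solve; _:=_; _:+_; _:*_; con)

  sumFin≡sum : ∀ {n} (g : Vector Carrier n) → sumFin g ≡ sum g
  sumFin≡sum {ℕ.zero}  g = ≡.refl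
  sumFin≡sum {ℕ.suc n} g = ≡.cong (g fzero +_) (sumFin≡sum (g ∘ fsuc))

  prodFin≡product : ∀ {n} (g : Vector Carrier n) → prodFin g ≡ product g
  prodFin≡product {ℕ.zero}  g = ≡.refl
  prodFin≡product {ℕ.suc n} g = ≡.cong (g fzero *_) (prodFin≡product (g ∘ fsuc))

  𝟙 : Bool → Carrier
  𝟙 true  = 1#
  𝟙 false = 0#

  0≤𝟙 : ∀ b → 0# ≤ 𝟙 b
  0≤𝟙 true  = 0≤1
  0≤𝟙 false = ≤-refl

  infix 7 _·_
  _·_ : (Edge → Carrier) → (Edge → Carrier) → Carrier
  x · v = sum (λ i → x i * v i)

  LPValue≈· : ∀ w x → LPValue w x ≈ x · w
  LPValue≈· w x = reflexive (sumFin≡sum (λ i → x i * w i))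

  sumOver≈· : ∀ F x → sumOver F x ≈ x · (𝟙 ∘ F)
  sumOver≈· F x = trans (reflexive (sumFin≡sum (λ i → if F i then x i else 0#))) (sum-cong-≋ select≈*𝟙)
    where
    select≈*𝟙 : ∀ i → (if F i then x i else 0#) ≈ x i * 𝟙 (F i)
    select≈*𝟙 i with F i
    ... | true  = sym (*-identityʳ (x i))
    ... | false = sym (zeroʳ (x i))

  singleton : Edge → Edge → Carrier
  singleton e i = 𝟙 (does (e ≟ i))

  singleton·v : ∀ e v → singleton e · v ≈ v e
  singleton·v e v = begin-equality
    singleton e · v         ≈⟨ sum-split-at +-commutativeMonoid e off-e refl ⟩
    𝟙 (does (e ≟ e)) * v e + sum {m} (λ _ → 0#) ≈⟨ +-cong at-e (sum-replicate-zero m) ⟩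
    v e + 0#               ≈⟨ +-identityʳ (v e) ⟩
    v e                    ∎
    where
    off-e : ∀ i → i ≢ e → 𝟙 (does (e ≟ i)) * v i ≈ 0#
    off-e i i≢e rewrite dec-false (e ≟ i) (i≢e ∘ ≡.sym) = zeroˡ (v i)
    at-e : 𝟙 (does (e ≟ e)) * v e ≈ v e
    at-e rewrite dec-true (e ≟ e) ≡.refl = *-identityˡ (v e)

  Blocked : List Edge → List Edge → Edge → Set
  Blocked M Q i = i ∈ Q ⊎ ¬ All (Disjoint i) M

  queryable⇒¬Blocked : ∀ {M Q e} → All (Disjoint e) M → e ∉ Q → ¬ Blocked M Q e
  queryable⇒¬Blocked e#M e∉Q (inj₁ e∈Q)  = e∉Q e∈Q
  queryable⇒¬Blocked e#M e∉Q (inj₂ ¬e#M) = ¬e#M e#M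

  incident⇒¬Disjoint : ∀ u {i e} → Incident u i → Incident u e → ¬ Disjoint i e
  incident⇒¬Disjoint (inj₁ _) u∈i u∈e (left≢ , _)  = left≢ (≡.trans u∈i (≡.sym u∈e))
  incident⇒¬Disjoint (inj₂ _) u∈i u∈e (_ , right≢) = right≢ (≡.trans u∈i (≡.sym u∈e))

  _∖_ : EdgeSet → Edge → EdgeSet
  (F ∖ e) i = if does (i ≟ e) then false else F i

  ∈-∖ : ∀ F e {i} → (F ∖ e) i ≡ true → F i ≡ true × i ≢ e
  ∈-∖ F e {i} i∈F∖e with i ≟ e
  ... | no i≢e = i∈F∖e , i≢e

  ·𝟙-vanishing : ∀ x F → (∀ i → F i ≡ true → x i ≈ 0#) → x · (𝟙 ∘ F) ≈ 0#
  ·𝟙-vanishing x F x≈0 = trans (sum-cong-≋ term≈0) (sum-replicate-zero m)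
    where
    term≈0 : ∀ i → x i * 𝟙 (F i) ≈ 0#
    term≈0 i with F i in i∈F
    ... | true  = trans (*-congʳ (x≈0 i i∈F)) (zeroˡ 1#)
    ... | false = zeroʳ (x i)

  ·𝟙-∖ : ∀ x F e → x e ≈ 0# → x · (𝟙 ∘ F) ≈ x · (𝟙 ∘ (F ∖ e))
  ·𝟙-∖ x F e x[e]≈0 = sum-cong-≋ term≈term
    where
    term≈term : ∀ i → x i * 𝟙 (F i) ≈ x i * 𝟙 ((F ∖ e) i)
    term≈term i with i ≟ e
    ... | yes ≡.refl = trans (*-congʳ x[e]≈0) (trans (zeroˡ _) (sym (trans (*-congʳ x[e]≈0) (zeroˡ _))))
    ... | no _       = refl

  Avoids : EdgeSet → List Edge → Set
  Avoids F Q = ∀ i → F i ≡ true → i ∉ Q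

  avoids-∷ : ∀ {F Q e} → F e ≡ false → Avoids F Q → Avoids F (e ∷ Q)
  avoids-∷ e∉F F#Q i i∈F (here ≡.refl) with () ← ≡.trans (≡.sym i∈F) e∉F
  avoids-∷ e∉F F#Q i i∈F (there i∈Q)   = F#Q i i∈F i∈Q

  ∖-avoids-∷ : ∀ {F Q} e → Avoids F Q → Avoids (F ∖ e) (e ∷ Q)
  ∖-avoids-∷ {F} e F#Q i i∈F∖e (here i≡e)  = proj₂ (∈-∖ F e i∈F∖e) i≡e
  ∖-avoids-∷ {F} e F#Q i i∈F∖e (there i∈Q) = F#Q i (proj₁ (∈-∖ F e i∈F∖e)) i∈Q

  ∖-⊆δ : ∀ {F u} e → F ⊆δ u → (F ∖ e) ⊆δ u
  ∖-⊆δ {F} e F⊆δu i i∈F∖e = F⊆δu i (proj₁ (∈-∖ F e i∈F∖e))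

  module CommitProbability
    (p : Edge → Carrier) (0≤p : ∀ e → 0# ≤ p e) (p≤1 : ∀ e → p e ≤ 1#)
    where

    commitProb : Alg → Edge → Carrier
    commitProb stop             i = 0#
    commitProb (query e T₁ T₀) i =
      p e * (singleton e i + commitProb T₁ i) + (1# - p e) * commitProb T₀ i

    0≤1-p : ∀ e → 0# ≤ 1# - p e
    0≤1-p e = x≤y⇒0≤y-x (p≤1 e)

    commitProb-nonneg : ∀ T i → 0# ≤ commitProb T i
    commitProb-nonneg stop             i = ≤-refl
    commitProb-nonneg (query e T₁ T₀) i =
      +-nonneg (*-nonneg (0≤p e) (+-nonneg (0≤𝟙 (does (e ≟ i))) (commitProb-nonneg T₁ i)))
               (*-nonneg (0≤1-p e) (commitProb-nonneg T₀ i))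

    commitProb-query· : ∀ e T₁ T₀ v →
      commitProb (query e T₁ T₀) · v ≈
      p e * (v e + commitProb T₁ · v) + (1# - p e) * (commitProb T₀ · v)
    commitProb-query· e T₁ T₀ v = begin-equality
      commitProb (query e T₁ T₀) · v
        ≈⟨ sum-cong-≋ (λ i → expand (p e) (singleton e i) (commitProb T₁ i) (1# - p e) (commitProb T₀ i) (v i)) ⟩
      sum (λ i → p e * (singleton e i * v i + commitProb T₁ i * v i) + (1# - p e) * (commitProb T₀ i * v i))
        ≈⟨ sum-linear semiring (p e) (1# - p e) (λ i → singleton e i * v i)
                                  (λ i → commitProb T₁ i * v i) (λ i → commitProb T₀ i * v i) ⟩
      p e * (singleton e · v + commitProb T₁ · v) + (1# - p e) * (commitProb T₀ · v)
        ≈⟨ +-congʳ (*-congˡ (+-congʳ (singleton·v e v))) ⟩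
      p e * (v e + commitProb T₁ · v) + (1# - p e) * (commitProb T₀ · v) ∎
      where
      expand : ∀ a s y b n w → (a * (s + y) + b * n) * w ≈ a * (s * w + y * w) + b * (n * w)
      expand = solve 6 (λ a s y b n w →
        (a :* (s :+ y) :+ b :* n) :* w := a :* (s :* w :+ y :* w) :+ b :* (n :* w)) refl

    utility≈commitProb·w : ∀ w T → utility p w T ≈ commitProb T · w
    utility≈commitProb·w w stop = begin-equality
      0#                     ≈⟨ sum-replicate-zero m ⟨
      sum {m} (λ _ → 0#)     ≈⟨ sum-cong-≋ (λ i → zeroˡ (w i)) ⟨
      commitProb stop · w    ∎
    utility≈commitProb·w w (query e T₁ T₀) = begin-equality
      utility p w (query e T₁ T₀)
        ≈⟨ +-cong (*-congˡ (+-congˡ (utility≈commitProb·w w T₁))) (*-congˡ (utility≈commitProb·w w T₀)) ⟩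
      p e * (w e + commitProb T₁ · w) + (1# - p e) * (commitProb T₀ · w)
        ≈⟨ commitProb-query· e T₁ T₀ w ⟨
      commitProb (query e T₁ T₀) · w ∎

    commitProb-blocked : ∀ {M Q T i} → Valid M Q T → Blocked M Q i → commitProb T i ≈ 0#
    commitProb-blocked stop _ = refl
    commitProb-blocked {M} {Q} {i = i} (query {e = e} {T₁} {T₀} e#M e∉Q valid-T₁ valid-T₀) blocked =
      begin-equality
      p e * (singleton e i + commitProb T₁ i) + (1# - p e) * commitProb T₀ i
        ≈⟨ +-cong (*-congˡ (+-cong singleton≈0 (commitProb-blocked valid-T₁ blocked-T₁)))
                  (*-congˡ (commitProb-blocked valid-T₀ blocked-T₀)) ⟩
      p e * (0# + 0#) + (1# - p e) * 0#
        ≈⟨ solve 2 (λ a b → a :* (con 0 :+ con 0) :+ b :* con 0 := con 0) refl (p e) (1# - p e) ⟩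
      0# ∎
      where
      e≢i : e ≢ i
      e≢i ≡.refl = queryable⇒¬Blocked e#M e∉Q blocked
      singleton≈0 : singleton e i ≈ 0#
      singleton≈0 rewrite dec-false (e ≟ i) e≢i = refl
      blocked-T₁ : Blocked (e ∷ M) (e ∷ Q) i
      blocked-T₁ = Sum.map there (λ ¬i#M → ¬i#M ∘ All.tail) blocked
      blocked-T₀ : Blocked M (e ∷ Q) i
      blocked-T₀ = Sum.map₁ there blocked

    f-factor : EdgeSet → Edge → Carrier
    f-factor F i = if F i then 1# - p i else 1#

    f-nonneg : ∀ F → 0# ≤ f p F
    f-nonneg F = x≤y⇒0≤y-x (begin
      prodFin (f-factor F)  ≡⟨ prodFin≡product (f-factor F) ⟩
      product (f-factor F)  ≤⟨ product≤1 (f-factor F) 0≤f-factor f-factor≤1 ⟩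
      1#                  ∎)
      where
      0≤f-factor : ∀ i → 0# ≤ f-factor F i
      0≤f-factor i with F i
      ... | true  = 0≤1-p i
      ... | false = 0≤1
      f-factor≤1 : ∀ i → f-factor F i ≤ 1#
      f-factor≤1 i with F i
      ... | true  = 0≤x⇒1-x≤1 (0≤p i)
      ... | false = ≤-refl

    prodFin-factor-∖ : ∀ F e → F e ≡ true → prodFin (f-factor F) ≈ (1# - p e) * prodFin (f-factor (F ∖ e))
    prodFin-factor-∖ F e e∈F = begin-equality
      prodFin (f-factor F)                        ≡⟨ prodFin≡product (f-factor F) ⟩
      product (f-factor F)                        ≈⟨ sum-split-at *-commutativeMonoid e agree-off-e f-factor[e]≈1 ⟩
      f-factor F e * product (f-factor (F ∖ e))   ≈⟨ *-congʳ (reflexive (≡.cong (λ b → if b then 1# - p e else 1#) e∈F)) ⟩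
      (1# - p e) * product (f-factor (F ∖ e))     ≡⟨ ≡.cong ((1# - p e) *_) (prodFin≡product (f-factor (F ∖ e))) ⟨
      (1# - p e) * prodFin (f-factor (F ∖ e))     ∎
      where
      agree-off-e : ∀ i → i ≢ e → f-factor F i ≈ f-factor (F ∖ e) i
      agree-off-e i i≢e rewrite dec-false (i ≟ e) i≢e = refl
      f-factor[e]≈1 : f-factor (F ∖ e) e ≈ 1#
      f-factor[e]≈1 rewrite dec-true (e ≟ e) ≡.refl = refl

    f-∖ : ∀ F e → F e ≡ true → f p F ≈ p e + (1# - p e) * f p (F ∖ e)
    f-∖ F e e∈F = begin-equality
      1# - prodFin (f-factor F)     ≈⟨ +-congˡ (-‿cong (prodFin-factor-∖ F e e∈F)) ⟩
      1# - q * P                    ≈⟨ +-congʳ (x+[y-x]≈y (p e) 1#) ⟨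
      (p e + q) - q * P             ≈⟨ solve 3 (λ a b n → (a :+ b) :+ n := a :+ (b :* con 1 :+ n)) refl (p e) q (- (q * P)) ⟩
      p e + (q * 1# - q * P)        ≈⟨ +-congˡ (x[y-z]≈xy-xz q 1# P) ⟨
      p e + q * (1# - P)            ∎
      where
      q P : Carrier
      q = 1# - p e
      P = prodFin (f-factor (F ∖ e))

    commitProb-feasible : ∀ {M Q T u F} → Valid M Q T → F ⊆δ u → Avoids F Q →
                          commitProb T · (𝟙 ∘ F) ≤ f p F
    commitProb-feasible {F = F} stop _ _ = begin
      commitProb stop · (𝟙 ∘ F)  ≈⟨ ·𝟙-vanishing (commitProb stop) F (λ _ _ → refl) ⟩
      0#                         ≤⟨ f-nonneg F ⟩
      f p F                      ∎
    commitProb-feasible {u = u} {F} (query {e = e} {T₁} {T₀} _ _ valid-T₁ valid-T₀) F⊆δu F#Q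
      with F e in F[e]
    ... | false = begin
      commitProb (query e T₁ T₀) · (𝟙 ∘ F)
        ≈⟨ commitProb-query· e T₁ T₀ (𝟙 ∘ F) ⟩
      p e * (𝟙 (F e) + commitProb T₁ · (𝟙 ∘ F)) + (1# - p e) * (commitProb T₀ · (𝟙 ∘ F))
        ≤⟨ +-mono-≤ (*-mono-≤ˡ (0≤p e) (+-mono-≤ (≤-reflexive 𝟙[F[e]]≈0) IH₁)) (*-mono-≤ˡ (0≤1-p e) IH₀) ⟩
      p e * (0# + f p F) + (1# - p e) * f p F
        ≈⟨ convex-combination-self (p e) (f p F) ⟩
      f p F ∎
      where
      𝟙[F[e]]≈0 : 𝟙 (F e) ≈ 0#
      𝟙[F[e]]≈0 = reflexive (≡.cong 𝟙 F[e])
      IH₁ : commitProb T₁ · (𝟙 ∘ F) ≤ f p F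
      IH₁ = commitProb-feasible valid-T₁ F⊆δu (avoids-∷ F[e] F#Q)
      IH₀ : commitProb T₀ · (𝟙 ∘ F) ≤ f p F
      IH₀ = commitProb-feasible valid-T₀ F⊆δu (avoids-∷ F[e] F#Q)
    ... | true = begin
      commitProb (query e T₁ T₀) · (𝟙 ∘ F)
        ≈⟨ commitProb-query· e T₁ T₀ (𝟙 ∘ F) ⟩
      p e * (𝟙 (F e) + commitProb T₁ · (𝟙 ∘ F)) + (1# - p e) * (commitProb T₀ · (𝟙 ∘ F))
        ≈⟨ +-cong (*-congˡ (+-cong 𝟙[F[e]]≈1 T₁-vanishes)) (*-congˡ T₀-ignores-e) ⟩
      p e * (1# + 0#) + (1# - p e) * (commitProb T₀ · (𝟙 ∘ (F ∖ e)))
        ≤⟨ +-mono-≤ˡ (p e * (1# + 0#)) (*-mono-≤ˡ (0≤1-p e) IH₀) ⟩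
      p e * (1# + 0#) + (1# - p e) * f p (F ∖ e)
        ≈⟨ +-congʳ (trans (*-congˡ (+-identityʳ 1#)) (*-identityʳ (p e))) ⟩
      p e + (1# - p e) * f p (F ∖ e)
        ≈⟨ f-∖ F e F[e] ⟨
      f p F ∎
      where
      𝟙[F[e]]≈1 : 𝟙 (F e) ≈ 1#
      𝟙[F[e]]≈1 = reflexive (≡.cong 𝟙 F[e])
      T₁-vanishes : commitProb T₁ · (𝟙 ∘ F) ≈ 0#
      T₁-vanishes = ·𝟙-vanishing (commitProb T₁) F λ i i∈F →
        commitProb-blocked valid-T₁ (inj₂ (incident⇒¬Disjoint u (F⊆δu i i∈F) (F⊆δu e F[e]) ∘ All.head))
      T₀-ignores-e : commitProb T₀ · (𝟙 ∘ F) ≈ commitProb T₀ · (𝟙 ∘ (F ∖ e))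
      T₀-ignores-e = ·𝟙-∖ (commitProb T₀) F e (commitProb-blocked valid-T₀ (inj₁ (here ≡.refl)))
      IH₀ : commitProb T₀ · (𝟙 ∘ (F ∖ e)) ≤ f p (F ∖ e)
      IH₀ = commitProb-feasible valid-T₀ (∖-⊆δ e F⊆δu) (∖-avoids-∷ e F#Q)

lemma1 : ∀ {c ℓ₁ ℓ₂ : Level} (K : OrderedField c ℓ₁ ℓ₂) (G : BipGraph) →
    let open OrderedField K in
    let open QueryCommit K G in
    (p w : Edge → Carrier) →
    (∀ e → 0# ≤ p e) → (∀ e → p e ≤ 1#) → (∀ e → 0# ≤ w e) →
    (T : Alg) → Valid [] [] T →
    ∃ λ (x : Edge → Carrier) → LPFeasible p x × (utility p w T ≤ LPValue w x)
lemma1 K G p w 0≤p p≤1 _ T valid =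
  commitProb T , (commitProb-nonneg T , constraint) , utility≤LPValue
  where
  open OrderedField K
  open QueryCommit K G
  open OrderedFieldProperties K
  open PosetReasoning poset
  open QueryCommitProperties K G
  open CommitProbability p 0≤p p≤1

  constraint : ∀ u F → F ⊆δ u → sumOver F (commitProb T) ≤ f p F
  constraint u F F⊆δu = begin
    sumOver F (commitProb T)  ≈⟨ sumOver≈· F (commitProb T) ⟩
    commitProb T · (𝟙 ∘ F)    ≤⟨ commitProb-feasible valid F⊆δu (λ _ _ ()) ⟩
    f p F                     ∎

  utility≤LPValue : utility p w T ≤ LPValue w (commitProb T)
  utility≤LPValue = ≤-reflexive (trans (utility≈commitProb·w w T) (sym (LPValue≈· w (commitProb T))))
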